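{- Let $Z\in\operatorname{SL}_2(\mathbb Z)$ and $t=\operatorname{Tr}Z$. If $4\mid t$, or if $t\equiv\pm1,\pm4\pmod9$, then $Z$ is not a commutator in $\operatorname{SL}_2(\mathbb Z)$. -}

module Defs where

open import Data.Integer using (ℤ; _+_; _*_; -_; _-_; +_)
open import Data.Integer.Divisibility using (_∣_)
open import Data.Product using (∃; _×_; _,_)
open import Relation.Binary.PropositionalEquality using (_≡_)

record M₂ : Set where
  constructor mat
  field
    a b c d : ℤ
open M₂ public

_·_ : M₂ → M₂ → M₂
mat a₁ b₁ c₁ d₁ · mat a₂ b₂ c₂ d₂ =
  mat (a₁ * a₂ + b₁ * c₂) (a₁ * b₂ + b₁ * d₂)
      (c₁ * a₂ + d₁ * c₂) (c₁ * b₂ + d₁ * d₂)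
infixl 7 _·_

det : M₂ → ℤ
det (mat a b c d) = a * d - b * c

tr : M₂ → ℤ
tr (mat a b c d) = a + d

SL₂ : M₂ → Set
SL₂ M = det M ≡ + 1

-- inverse in SL₂(ℤ) (the adjugate; equals the inverse when det = 1)
inv : M₂ → M₂
inv (mat a b c d) = mat d (- b) (- c) a

IsCommutator : M₂ → Set
IsCommutator Z = ∃ λ X → ∃ λ Y → SL₂ X × SL₂ Y × (Z ≡ X · Y · inv X · inv Y)

{-# OPTIONS --safe #-}
module Submission where

-- For X, Y ∈ SL₂(ℤ) the trace of X Y X⁻¹ Y⁻¹ is 2 + defect, a polynomial in the entries
-- b, c, a − d of X and f, g, e − h of Y.  Modulo m, the defect depends only on these entries modulo m,
-- and they form the corresponding entries of a matrix of determinant 1 over ℤ/m.  Running over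
-- all such pairs for m = 4 and m = 9 shows that tr [X , Y] is never 0 mod 4 and never ±1, ±4 mod 9.

open import Defs
open import Data.Bool using (Bool; T; true)
open import Data.Bool.ListAction using (all; any)
open import Data.Bool.Properties using (T-≡)
open import Data.Integer using (ℤ; +_; -_; _+_; _-_; _*_; ∣_∣; _%ℕ_; _/ℕ_)
open import Data.Integer.DivMod using (a≡a%ℕn+[a/ℕn]*n; n%ℕd<d)
open import Data.Integer.Divisibility using (_∣_)
import Data.Integer.Divisibility.Signed as Signed
open import Data.Integer.Properties using (+-identityʳ)
open import Data.Integer.Tactic.RingSolver using (solve-∀)
open import Data.List using (List; []; _∷_; map; upTo; filterᵇ; cartesianProduct)
open import Data.List.Membership.Propositional using (_∈_; lose)
open import Data.List.Membership.Propositional.Properties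
  using (∈-map⁺; ∈-upTo⁺; ∈-filter⁺; ∈-cartesianProduct⁺)
import Data.List.Relation.Unary.All as All
open import Data.List.Relation.Unary.All.Properties using (all⁺)
open import Data.List.Relation.Unary.Any using (here; there)
open import Data.List.Relation.Unary.Any.Properties using (any⁺)
open import Data.Nat using (ℕ; NonZero)
open import Data.Nat.Divisibility using (_∣?_; _∣0)
open import Data.Product using (_×_; _,_)
open import Data.Sum using (_⊎_; inj₁; inj₂)
open import Function using (_∘_)
open import Function.Bundles using (module Equivalence)
open import Relation.Binary.PropositionalEquality using (_≡_; refl; sym; trans; cong₂; subst)
open import Relation.Nullary using (¬_)
open import Relation.Nullary.Decidable using (isYes; isNo; T?; fromWitness; toWitnessFalse)

record _≡_mod_ (x y m : ℤ) : Set where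
  constructor congruent
  field
    quotient : ℤ
    x≡y+q*m  : x ≡ y + quotient * m

infix 4 _≡_mod_

module _ {m : ℤ} where

  mod-refl : ∀ {x} → x ≡ x mod m
  mod-refl {x} = congruent (+ 0) (sym (+-identityʳ x))

  +-cong-mod : ∀ {x y x′ y′} → x ≡ y mod m → x′ ≡ y′ mod m → x + x′ ≡ y + y′ mod m
  +-cong-mod {y = y} {y′ = y′} (congruent q refl) (congruent q′ refl) =
    congruent (q + q′) (identity y y′ q q′ m)
    where
    identity : ∀ y y′ q q′ m → (y + q * m) + (y′ + q′ * m) ≡ (y + y′) + (q + q′) * m
    identity = solve-∀

  -‿cong-mod : ∀ {x y x′ y′} → x ≡ y mod m → x′ ≡ y′ mod m → x - x′ ≡ y - y′ mod m
  -‿cong-mod {y = y} {y′ = y′} (congruent q refl) (congruent q′ refl) =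
    congruent (q - q′) (identity y y′ q q′ m)
    where
    identity : ∀ y y′ q q′ m → (y + q * m) - (y′ + q′ * m) ≡ (y - y′) + (q - q′) * m
    identity = solve-∀

  *-cong-mod : ∀ {x y x′ y′} → x ≡ y mod m → x′ ≡ y′ mod m → x * x′ ≡ y * y′ mod m
  *-cong-mod {y = y} {y′ = y′} (congruent q refl) (congruent q′ refl) =
    congruent (q * y′ + y * q′ + q * q′ * m) (identity y y′ q q′ m)
    where
    identity : ∀ y y′ q q′ m →
               (y + q * m) * (y′ + q′ * m) ≡ y * y′ + (q * y′ + y * q′ + q * q′ * m) * m
    identity = solve-∀

  ∣-resp-mod : ∀ {x y} → x ≡ y mod m → m ∣ x → m ∣ y
  ∣-resp-mod {y = y} (congruent q refl) m∣x =
    Signed.∣⇒∣ᵤ (subst (Signed._∣_ m) (identity y q m)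
      (Signed.∣m∣n⇒∣m-n (Signed.∣ᵤ⇒∣ {m} {y + q * m} m∣x) (Signed.∣n⇒∣m*n q Signed.∣-refl)))
    where
    identity : ∀ y q m → (y + q * m) - q * m ≡ y
    identity = solve-∀

reduce : (m : ℕ) .{{_ : NonZero m}} → ℤ → ℤ
reduce m x = + (x %ℕ m)

≡-reduce : ∀ m .{{_ : NonZero m}} x → x ≡ reduce m x mod + m
≡-reduce m x = congruent (x /ℕ m) (a≡a%ℕn+[a/ℕn]*n x m)

residues : ℕ → List ℤ
residues m = map +_ (upTo m)

reduce∈residues : ∀ m .{{_ : NonZero m}} x → reduce m x ∈ residues m
reduce∈residues m x = ∈-map⁺ +_ (∈-upTo⁺ (n%ℕd<d x m))

-- (b , c , a − d) determines the traceless part X − (tr X / 2)·I of X = mat a b c d.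
Shape : Set
Shape = ℤ × ℤ × ℤ

shape : M₂ → Shape
shape (mat a b c d) = b , c , a - d

reduceShape : (m : ℕ) .{{_ : NonZero m}} → Shape → Shape
reduceShape m (b , c , u) = reduce m b , reduce m c , reduce m u

defect : Shape → Shape → ℤ
defect (b , c , u) (f , g , v) = (b * g - c * f) * (b * g - c * f) + (f * u - b * v) * (c * v - g * u)

tr-commutator : ∀ X Y → tr (X · Y · inv X · inv Y) ≡ + 2 * det X * det Y + defect (shape X) (shape Y)
tr-commutator (mat a b c d) (mat e f g h) = identity a b c d e f g h
  where
  identity : ∀ a b c d e f g h →
    ((a * e + b * g) * d + (a * f + b * h) * (- c)) * h + ((a * e + b * g) * (- b) + (a * f + b * h) * a) * (- g)
    + (((c * e + d * g) * d + (c * f + d * h) * (- c)) * (- f) + ((c * e + d * g) * (- b) + (c * f + d * h) * a) * e)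
    ≡ + 2 * (a * d - b * c) * (e * h - f * g)
      + ((b * g - c * f) * (b * g - c * f) + (f * (a - d) - b * (e - h)) * (c * (e - h) - g * (a - d)))
  identity = solve-∀

defect-reduce : ∀ m .{{_ : NonZero m}} s s′ → defect s s′ ≡ defect (reduceShape m s) (reduceShape m s′) mod + m
defect-reduce m (b , c , u) (f , g , v) =
  +-cong-mod (*-cong-mod bg-cf bg-cf)
             (*-cong-mod (-‿cong-mod (product f u) (product b v)) (-‿cong-mod (product c v) (product g u)))
  where
  product : ∀ x y → x * y ≡ reduce m x * reduce m y mod + m
  product x y = *-cong-mod (≡-reduce m x) (≡-reduce m y)
  bg-cf : b * g - c * f ≡ reduce m b * reduce m g - reduce m c * reduce m f mod + m
  bg-cf = -‿cong-mod (product b g) (product c f)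

tr-commutator-SL₂ : ∀ X Y → SL₂ X → SL₂ Y →
                    tr (X · Y · inv X · inv Y) ≡ + 2 + defect (shape X) (shape Y)
tr-commutator-SL₂ X Y detX detY =
  trans (tr-commutator X Y) (cong₂ (λ δ δ′ → + 2 * δ * δ′ + defect (shape X) (shape Y)) detX detY)

-- mat a b c (a − u) is the matrix of shape (b , c , u) with upper-left entry a.
liftable : (m : ℕ) .{{_ : NonZero m}} → Shape → Bool
liftable m (b , c , u) = any (λ a → isYes (m ∣? ∣ a * (a - u) - b * c - + 1 ∣)) (residues m)

admissibleShapes : (m : ℕ) .{{_ : NonZero m}} → List Shape
admissibleShapes m =
  filterᵇ (liftable m) (cartesianProduct (residues m) (cartesianProduct (residues m) (residues m)))

reduceShape-admissible : ∀ m .{{_ : NonZero m}} X → SL₂ X → reduceShape m (shape X) ∈ admissibleShapes m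
reduceShape-admissible m (mat a b c d) detX =
  ∈-filter⁺ (T? ∘ liftable m)
    (∈-cartesianProduct⁺ (reduce∈residues m b)
      (∈-cartesianProduct⁺ (reduce∈residues m c) (reduce∈residues m (a - d))))
    (any⁺ _ (lose (reduce∈residues m a) (fromWitness (∣-resp-mod reduced m∣det-1))))
  where
  r : ∀ x → x ≡ reduce m x mod + m
  r = ≡-reduce m
  reduced : a * (a - (a - d)) - b * c - + 1
          ≡ reduce m a * (reduce m a - reduce m (a - d)) - reduce m b * reduce m c - + 1 mod + m
  reduced = -‿cong-mod (-‿cong-mod (*-cong-mod (r a) (-‿cong-mod (r a) (r (a - d)))) (*-cong-mod (r b) (r c)))
                       mod-refl
  m∣det-1 : + m ∣ a * (a - (a - d)) - b * c - + 1
  m∣det-1 = subst (λ δ → + m ∣ δ - + 1) (sym (trans (identity a b c d) detX)) (m ∣0)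
    where
    identity : ∀ a b c d → a * (a - (a - d)) - b * c ≡ a * d - b * c
    identity = solve-∀

allPairs : {A : Set} → (A → A → Bool) → List A → Bool
allPairs p xs = all (λ x → all (p x) xs) xs

allPairs-sound : ∀ {A : Set} (p : A → A → Bool) {xs x y} → T (allPairs p xs) → x ∈ xs → y ∈ xs → T (p x y)
allPairs-sound p {xs} {x} all-p x∈xs y∈xs = All.lookup (all⁺ (p x) xs (All.lookup (all⁺ _ xs all-p) x∈xs)) y∈xs

avoids : (m : ℕ) → List ℤ → ℤ → Bool
avoids m ks t = all (λ k → isNo (m ∣? ∣ t + k ∣)) ks

commutatorTracesAvoid : (m : ℕ) .{{_ : NonZero m}} → List ℤ → Bool
commutatorTracesAvoid m ks = allPairs (λ s s′ → avoids m ks (+ 2 + defect s s′)) (admissibleShapes m)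

commutatorTrace-avoids : ∀ m .{{_ : NonZero m}} ks → commutatorTracesAvoid m ks ≡ true → ∀ {k} → k ∈ ks →
                         ∀ X Y → SL₂ X → SL₂ Y → ¬ (+ m ∣ tr (X · Y · inv X · inv Y) + k)
commutatorTrace-avoids m ks avoid {k} k∈ks X Y detX detY =
  toWitnessFalse (All.lookup (all⁺ _ ks X′Y′-avoid) k∈ks) ∘ ∣-resp-mod reduced
  where
  X′ Y′ : Shape
  X′ = reduceShape m (shape X)
  Y′ = reduceShape m (shape Y)
  X′Y′-avoid : T (avoids m ks (+ 2 + defect X′ Y′))
  X′Y′-avoid = allPairs-sound _ (Equivalence.from T-≡ avoid)
                              (reduceShape-admissible m X detX) (reduceShape-admissible m Y detY)
  reduced : tr (X · Y · inv X · inv Y) + k ≡ + 2 + defect X′ Y′ + k mod + m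
  reduced = subst (λ t → t + k ≡ + 2 + defect X′ Y′ + k mod + m) (sym (tr-commutator-SL₂ X Y detX detY))
                  (+-cong-mod (+-cong-mod (mod-refl {x = + 2}) (defect-reduce m (shape X) (shape Y))) (mod-refl {x = k}))

commutatorTraces-mod4 : commutatorTracesAvoid 4 (+ 0 ∷ []) ≡ true
commutatorTraces-mod4 = refl

commutatorTraces-mod9 : commutatorTracesAvoid 9 (- + 1 ∷ + 1 ∷ - + 4 ∷ + 4 ∷ []) ≡ true
commutatorTraces-mod9 = refl

commutatorTrace-≢0-mod4 : ∀ X Y → SL₂ X → SL₂ Y → ¬ (+ 4 ∣ tr (X · Y · inv X · inv Y))
commutatorTrace-≢0-mod4 X Y detX detY 4∣t =
  commutatorTrace-avoids 4 (+ 0 ∷ []) commutatorTraces-mod4 (here refl) X Y detX detY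
                         (subst (+ 4 ∣_) (sym (+-identityʳ (tr (X · Y · inv X · inv Y)))) 4∣t)

commutatorTrace-≢±1,±4-mod9 : ∀ X Y → SL₂ X → SL₂ Y → ∀ {k} → k ∈ - + 1 ∷ + 1 ∷ - + 4 ∷ + 4 ∷ [] →
                              ¬ (+ 9 ∣ tr (X · Y · inv X · inv Y) + k)
commutatorTrace-≢±1,±4-mod9 X Y detX detY k∈ks =
  commutatorTrace-avoids 9 (- + 1 ∷ + 1 ∷ - + 4 ∷ + 4 ∷ []) commutatorTraces-mod9 k∈ks X Y detX detY

lemma5p11 : (Z : M₂) → SL₂ Z →
            ((+ 4 ∣ tr Z) ⊎ (+ 9 ∣ (tr Z - + 1)) ⊎ (+ 9 ∣ (tr Z + + 1)) ⊎ (+ 9 ∣ (tr Z - + 4)) ⊎ (+ 9 ∣ (tr Z + + 4))) →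
            ¬ IsCommutator Z
lemma5p11 _ _ (inj₁ 4∣t) (X , Y , detX , detY , refl) =
  commutatorTrace-≢0-mod4 X Y detX detY 4∣t
lemma5p11 _ _ (inj₂ (inj₁ 9∣t-1)) (X , Y , detX , detY , refl) =
  commutatorTrace-≢±1,±4-mod9 X Y detX detY (here refl) 9∣t-1
lemma5p11 _ _ (inj₂ (inj₂ (inj₁ 9∣t+1))) (X , Y , detX , detY , refl) =
  commutatorTrace-≢±1,±4-mod9 X Y detX detY (there (here refl)) 9∣t+1
lemma5p11 _ _ (inj₂ (inj₂ (inj₂ (inj₁ 9∣t-4)))) (X , Y , detX , detY , refl) =
  commutatorTrace-≢±1,±4-mod9 X Y detX detY (there (there (here refl))) 9∣t-4
lemma5p11 _ _ (inj₂ (inj₂ (inj₂ (inj₂ 9∣t+4)))) (X , Y , detX , detY , refl) =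
  commutatorTrace-≢±1,±4-mod9 X Y detX detY (there (there (there (here refl)))) 9∣t+4
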